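{- Let $t \ge 3$ be an integer and let $G$ be a finite simple connected graph. If $G$ contains two vertices $x_i$ and $x_j$ such that $|N_G(x_i) \triangle N_G(x_j)| = 2$, then $M_t(G)$ is not a distance magic graph.
   Context: $N_G(x)$ denotes the open neighbourhood of $x$ in $G$ and $\triangle$ denotes symmetric difference. For a graph $G=(V,E)$ and an integer $t \ge 1$, the generalised Mycielskian $M_t(G)$ is the graph with vertex set $(V \times \{0,1,\dots,t-1\}) \cup \{u\}$ (where $u$ is a new vertex), whose edges are: $(x,0)(y,0)$ for every edge $xy \in E$; $(x,i)(y,i+1)$ for every $0 \le i \le t-2$ and every ordered pair $(x,y)$ with $xy \in E$; and $(x,t-1)u$ for every $x \in V$. A graph $H$ on $N$ vertices is distance magic if there is a bijection $f: V(H) \to \{1,2,\dots,N\}$ and a constant $k$ such that for every vertex $v$, $\sum_{w \in N(v)} f(w) = k$. -}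

module Defs where

open import Data.Nat using (ℕ; zero; suc; _+_; _*_; _≡ᵇ_)
open import Data.Bool using (Bool; true; false; _∧_; _∨_; _xor_; if_then_else_; T)
open import Data.Fin using (Fin; toℕ)
open import Data.Product using (Σ; _×_; _,_; ∃)
open import Data.Sum using (_⊎_; inj₁; inj₂)
open import Data.Unit using (⊤; tt)
open import Function.Bundles using (_↔_; Inverse)
open import Relation.Binary.PropositionalEquality using (_≡_)

∑ : ∀ {N} → (Fin N → ℕ) → ℕ
∑ {zero}  f = 0
∑ {suc N} f = f Fin.zero + ∑ (λ i → f (Fin.suc i))

record Graph : Set where
  field
    n      : ℕ
    adj    : Fin n → Fin n → Bool
    sym    : ∀ x y → adj x y ≡ adj y x
    irrefl : ∀ x → adj x x ≡ false
open Graph public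

data Reach (G : Graph) : Fin (n G) → Fin (n G) → Set where
  here : ∀ {x} → Reach G x x
  step : ∀ {x y z} → T (adj G x y) → Reach G y z → Reach G x z

Connected : Graph → Set
Connected G = ∀ x y → Reach G x y

symDiffSize : (G : Graph) → Fin (n G) → Fin (n G) → ℕ
symDiffSize G x y = ∑ (λ z → if adj G x z xor adj G y z then 1 else 0)

-- Distance magic for a graph on a vertex type V with N vertices
-- (the labelling is f w = 1 + to g w for a bijection g : V ↔ Fin N;
--  sums over V are taken by reindexing along g).
DistanceMagic : (V : Set) (N : ℕ) (adj' : V → V → Bool) → Set
DistanceMagic V N adj' =
  Σ (V ↔ Fin N) λ g → ∃ λ (k : ℕ) → ∀ (v : V) →
    ∑ (λ (i : Fin N) → if adj' v (Inverse.from g i) then suc (toℕ i) else 0) ≡ k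

MycV : Graph → ℕ → Set
MycV G t = (Fin (n G) × Fin t) ⊎ ⊤

mycAdj : (G : Graph) (t : ℕ) → MycV G t → MycV G t → Bool
mycAdj G t (inj₁ (x , i)) (inj₁ (y , j)) =
  adj G x y ∧ (((toℕ i ≡ᵇ 0) ∧ (toℕ j ≡ᵇ 0)) ∨ (suc (toℕ i) ≡ᵇ toℕ j) ∨ (suc (toℕ j) ≡ᵇ toℕ i))
mycAdj G t (inj₁ (x , i)) (inj₂ tt) = suc (toℕ i) ≡ᵇ t
mycAdj G t (inj₂ tt) (inj₁ (y , j)) = suc (toℕ j) ≡ᵇ t
mycAdj G t (inj₂ tt) (inj₂ tt) = false

MycDistanceMagic : Graph → ℕ → Set
MycDistanceMagic G t = DistanceMagic (MycV G t) (n G * t + 1) (mycAdj G t)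

{-# OPTIONS --safe #-}
-- The vertices (x, t-1) of the top layer of M_t(G) are adjacent exactly to the
-- apex u and to the copies (y, t-2) of the neighbours y of x.  Equal label sums
-- at (xi, t-1) and (xj, t-1) therefore force the labels on the penultimate
-- copies of N(xi) ∖ N(xj) and of N(xj) ∖ N(xi) to have equal sums.  These two
-- sets have two elements in total: if one of them is empty the other sum is
-- positive, and if both are singletons two distinct vertices get the same label.
module Submission where

open import Defs hiding (sym)
open import Algebra.Properties.CommutativeSemigroup using (interchange)
open import Data.Bool using (Bool; true; false; not; _∧_; _xor_; if_then_else_)
open import Data.Bool.Properties using (∧-zeroʳ; ∧-identityʳ; ∧-inverseʳ; T-≡)
open import Data.Empty using (⊥)
open import Data.Fin using (Fin; toℕ; fromℕ; inject₁)
open import Data.Fin.Properties using (toℕ-injective; toℕ-fromℕ; toℕ-inject₁; toℕ≤pred[n])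
open import Data.Nat using (ℕ; zero; suc; _+_; _*_; _≡ᵇ_; _≤_; _≥_; s≤s)
open import Data.Nat.Properties
  using (+-identityʳ; +-comm; +-cancelˡ-≡; m≤m+n; m≤n+m; ≤-trans; suc-injective; n≮0; ≡ᵇ⇒≡;
         +-commutativeSemigroup; module ≤-Reasoning)
open import Data.Product using (_×_; _,_; ∃)
open import Data.Product.Properties using (,-injectiveˡ)
open import Data.Sum using (inj₁; inj₂)
open import Data.Sum.Properties using (inj₁-injective)
open import Data.Unit using (tt)
open import Function.Bundles using (_↔_; Inverse; Equivalence)
open import Relation.Binary.PropositionalEquality
  using (_≡_; _≢_; refl; sym; trans; cong; cong₂; subst; module ≡-Reasoning)
open import Relation.Nullary using (¬_; contradiction)

∑-cong : ∀ {N} {f g : Fin N → ℕ} → (∀ i → f i ≡ g i) → ∑ f ≡ ∑ g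
∑-cong {zero}  f≗g = refl
∑-cong {suc N} f≗g = cong₂ _+_ (f≗g Fin.zero) (∑-cong (λ i → f≗g (Fin.suc i)))

∑-distrib-+ : ∀ {N} (f g : Fin N → ℕ) → ∑ (λ i → f i + g i) ≡ ∑ f + ∑ g
∑-distrib-+ {zero}  f g = refl
∑-distrib-+ {suc N} f g =
  trans (cong (f Fin.zero + g Fin.zero +_) (∑-distrib-+ (λ i → f (Fin.suc i)) (λ i → g (Fin.suc i))))
        (interchange +-commutativeSemigroup (f Fin.zero) (g Fin.zero) _ _)

∑-zeros : ∀ {N} (f : Fin N → ℕ) → (∀ i → f i ≡ 0) → ∑ f ≡ 0
∑-zeros {zero}  f f≗0 = refl
∑-zeros {suc N} f f≗0 =
  cong₂ _+_ (f≗0 Fin.zero) (∑-zeros (λ i → f (Fin.suc i)) (λ i → f≗0 (Fin.suc i)))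

∑-single : ∀ {N} (f : Fin N → ℕ) (k : Fin N) → (∀ i → i ≢ k → f i ≡ 0) → ∑ f ≡ f k
∑-single f Fin.zero others =
  trans (cong (f Fin.zero +_) (∑-zeros _ (λ i → others (Fin.suc i) λ ())))
        (+-identityʳ (f Fin.zero))
∑-single f (Fin.suc k) others =
  cong₂ _+_ (others Fin.zero λ ())
            (∑-single (λ i → f (Fin.suc i)) k (λ i i≢k → others (Fin.suc i) (λ { refl → i≢k refl })))

≤-∑ : ∀ {N} (f : Fin N → ℕ) (k : Fin N) → f k ≤ ∑ f
≤-∑ f Fin.zero    = m≤m+n (f Fin.zero) _
≤-∑ f (Fin.suc k) = ≤-trans (≤-∑ (λ i → f (Fin.suc i)) k) (m≤n+m _ (f Fin.zero))

infixl 6 _∖_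
_∖_ : {A : Set} → (A → Bool) → (A → Bool) → A → Bool
(P ∖ Q) x = P x ∧ not (Q x)

indicator : ∀ {N} → (Fin N → Bool) → Fin N → ℕ
indicator p i = if p i then 1 else 0

count : ∀ {N} → (Fin N → Bool) → ℕ
count p = ∑ (indicator p)

count-xor : ∀ {N} (p q : Fin N → Bool) → count (λ i → p i xor q i) ≡ count (p ∖ q) + count (q ∖ p)
count-xor p q =
  trans (∑-cong (λ i → indicator-xor (p i) (q i))) (∑-distrib-+ (indicator (p ∖ q)) (indicator (q ∖ p)))
  where
  indicator-xor : ∀ x y → (if x xor y then 1 else 0) ≡
                         (if x ∧ not y then 1 else 0) + (if y ∧ not x then 1 else 0)
  indicator-xor false false = refl
  indicator-xor false true  = refl
  indicator-xor true  false = refl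
  indicator-xor true  true  = refl

count-≡0 : ∀ {N} (p : Fin N → Bool) → count p ≡ 0 → ∀ i → p i ≡ false
count-≡0 {suc N} p count≡0 i with p Fin.zero in p0
count-≡0 {suc N} p ()      i           | true
count-≡0 {suc N} p count≡0 Fin.zero    | false = p0
count-≡0 {suc N} p count≡0 (Fin.suc i) | false = count-≡0 (λ j → p (Fin.suc j)) count≡0 i

count-≡1 : ∀ {N} (p : Fin N → Bool) → count p ≡ 1 →
           ∃ λ i → p i ≡ true × ∀ j → p j ≡ true → j ≡ i
count-≡1 {suc N} p count≡1 with p Fin.zero in p0
... | true = Fin.zero , p0 , only-zero
  where
  only-zero : ∀ j → p j ≡ true → j ≡ Fin.zero
  only-zero Fin.zero    _  = refl
  only-zero (Fin.suc j) pj =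
    contradiction (trans (sym (count-≡0 (λ k → p (Fin.suc k)) (suc-injective count≡1) j)) pj) λ ()
... | false with count-≡1 (λ k → p (Fin.suc k)) count≡1
... | i , pi , unique = Fin.suc i , pi , only-suc
  where
  only-suc : ∀ j → p j ≡ true → j ≡ Fin.suc i
  only-suc Fin.zero    pj = contradiction (trans (sym p0) pj) λ ()
  only-suc (Fin.suc j) pj = cong Fin.suc (unique j pj)

count-≡suc : ∀ {N} (p : Fin N → Bool) {c} → count p ≡ suc c → ∃ λ i → p i ≡ true
count-≡suc {suc N} p count≡suc with p Fin.zero in p0
... | true  = Fin.zero , p0
... | false with count-≡suc (λ k → p (Fin.suc k)) count≡suc
... | i , pi = Fin.suc i , pi

module LabelSums {V : Set} {N : ℕ} (g : V ↔ Fin N) where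
  open Inverse g

  label : V → ℕ
  label v = suc (toℕ (to v))

  labelIf : (V → Bool) → Fin N → ℕ
  labelIf P i = if P (from i) then suc (toℕ i) else 0

  labelSum : (V → Bool) → ℕ
  labelSum P = ∑ (labelIf P)

  label-injective : ∀ {v w} → label v ≡ label w → v ≡ w
  label-injective {v} {w} eq = begin
    v             ≡⟨ strictlyInverseʳ v ⟨
    from (to v)   ≡⟨ cong from (toℕ-injective (suc-injective eq)) ⟩
    from (to w)   ≡⟨ strictlyInverseʳ w ⟩
    w             ∎
    where open ≡-Reasoning

  labelIf-to : ∀ {P v} → P v ≡ true → labelIf P (to v) ≡ label v
  labelIf-to {P} {v} Pv rewrite strictlyInverseʳ v | Pv = refl

  labelSum-empty : ∀ {P} → (∀ v → P v ≡ false) → labelSum P ≡ 0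
  labelSum-empty {P} empty =
    ∑-zeros (labelIf P) (λ i → cong (λ b → if b then suc (toℕ i) else 0) (empty (from i)))

  label-≤-labelSum : ∀ {P v} → P v ≡ true → label v ≤ labelSum P
  label-≤-labelSum {P} {v} Pv = subst (_≤ labelSum P) (labelIf-to {P} Pv) (≤-∑ (labelIf P) (to v))

  labelSum-single : ∀ {P v} → P v ≡ true → (∀ w → P w ≡ true → w ≡ v) → labelSum P ≡ label v
  labelSum-single {P} {v} Pv unique = trans (∑-single (labelIf P) (to v) vanish) (labelIf-to {P} Pv)
    where
    vanish : ∀ i → i ≢ to v → labelIf P i ≡ 0
    vanish i i≢ with P (from i) in Pi
    ... | false = refl
    ... | true  = contradiction (trans (sym (strictlyInverseˡ i)) (cong to (unique (from i) Pi))) i≢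

  labelSum-∖-≡ : ∀ {P Q} → labelSum P ≡ labelSum Q → labelSum (P ∖ Q) ≡ labelSum (Q ∖ P)
  labelSum-∖-≡ {P} {Q} P≡Q = sym (+-cancelˡ-≡ (labelSum P) _ _ (begin
    labelSum P + labelSum (Q ∖ P)                   ≡⟨ ∑-distrib-+ (labelIf P) (labelIf (Q ∖ P)) ⟨
    ∑ (λ i → labelIf P i + labelIf (Q ∖ P) i)       ≡⟨ ∑-cong (λ i → split (P (from i)) (Q (from i)) _) ⟩
    ∑ (λ i → labelIf Q i + labelIf (P ∖ Q) i)       ≡⟨ ∑-distrib-+ (labelIf Q) (labelIf (P ∖ Q)) ⟩
    labelSum Q + labelSum (P ∖ Q)                   ≡⟨ cong (_+ labelSum (P ∖ Q)) P≡Q ⟨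
    labelSum P + labelSum (P ∖ Q)                   ∎))
    where
    open ≡-Reasoning
    split : ∀ x y s → (if x then s else 0) + (if y ∧ not x then s else 0)
                    ≡ (if y then s else 0) + (if x ∧ not y then s else 0)
    split false false s = refl
    split false true  s = +-comm 0 s
    split true  false s = +-comm s 0
    split true  true  s = refl

∖-asym : {A : Set} (P Q : A → Bool) (x : A) → (P ∖ Q) x ≡ true → (Q ∖ P) x ≡ false
∖-asym P Q x P∖Qx with P x | Q x
∖-asym P Q x refl | true | false = refl

∧-∖-∧ : ∀ x y e → (x ∧ e) ∧ not (y ∧ e) ≡ (x ∧ not y) ∧ e
∧-∖-∧ false y     e     = refl
∧-∖-∧ true  y     false = sym (∧-zeroʳ (not y))
∧-∖-∧ true  false true  = refl
∧-∖-∧ true  true  true  = refl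

suc-≡ᵇ-false : ∀ {m n} → n ≤ m → (suc m ≡ᵇ n) ≡ false
suc-≡ᵇ-false {n = zero}  _         = refl
suc-≡ᵇ-false {n = suc n} (s≤s n≤m) = suc-≡ᵇ-false n≤m

≡ᵇ-refl : ∀ m → (m ≡ᵇ m) ≡ true
≡ᵇ-refl zero    = refl
≡ᵇ-refl (suc m) = ≡ᵇ-refl m

module TopLayer (G : Graph) (s : ℕ) where

  top penultimate : Fin (n G) → MycV G (suc (suc s))
  top         a = inj₁ (a , fromℕ (suc s))
  penultimate z = inj₁ (z , inject₁ (fromℕ s))

  nbr : Fin (n G) → MycV G (suc (suc s)) → Bool
  nbr a = mycAdj G (suc (suc s)) (top a)

  penultimate-injective : ∀ {z w} → penultimate z ≡ penultimate w → z ≡ w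
  penultimate-injective eq = ,-injectiveˡ (inj₁-injective eq)

  nbr-layer : ∀ a z j → nbr a (inj₁ (z , j)) ≡ adj G a z ∧ (toℕ j ≡ᵇ s)
  nbr-layer a z j rewrite toℕ-fromℕ s | suc-≡ᵇ-false (toℕ≤pred[n] j) = refl

  nbr∖nbr-layer : ∀ a b z j →
                  (nbr a ∖ nbr b) (inj₁ (z , j)) ≡ (adj G a ∖ adj G b) z ∧ (toℕ j ≡ᵇ s)
  nbr∖nbr-layer a b z j rewrite nbr-layer a z j | nbr-layer b z j = ∧-∖-∧ (adj G a z) (adj G b z) _

  nbr∖nbr-penultimate : ∀ a b z → (nbr a ∖ nbr b) (penultimate z) ≡ (adj G a ∖ adj G b) z
  nbr∖nbr-penultimate a b z rewrite nbr∖nbr-layer a b z (inject₁ (fromℕ s))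
                                  | toℕ-inject₁ (fromℕ s) | toℕ-fromℕ s | ≡ᵇ-refl s =
    ∧-identityʳ _

  nbr∖nbr-support : ∀ a b v → (nbr a ∖ nbr b) v ≡ true →
                    ∃ λ z → v ≡ penultimate z × (adj G a ∖ adj G b) z ≡ true
  nbr∖nbr-support a b (inj₂ tt) apex rewrite ∧-inverseʳ (nbr a (inj₂ tt)) = contradiction apex λ ()
  nbr∖nbr-support a b (inj₁ (z , j)) v∈ rewrite nbr∖nbr-layer a b z j with toℕ j ≡ᵇ s in j≡s
  ... | false = contradiction (trans (sym (∧-zeroʳ _)) v∈) λ ()
  ... | true  = z , cong (λ j → inj₁ (z , j)) j≡penultimate , trans (sym (∧-identityʳ _)) v∈
    where
    j≡penultimate : j ≡ inject₁ (fromℕ s)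
    j≡penultimate = toℕ-injective (begin
      toℕ j                    ≡⟨ ≡ᵇ⇒≡ _ _ (Equivalence.from T-≡ j≡s) ⟩
      s                        ≡⟨ toℕ-fromℕ s ⟨
      toℕ (fromℕ s)            ≡⟨ toℕ-inject₁ (fromℕ s) ⟨
      toℕ (inject₁ (fromℕ s))  ∎)
      where open ≡-Reasoning

  nbr∖nbr-empty : ∀ a b → (∀ z → (adj G a ∖ adj G b) z ≡ false) →
                  ∀ v → (nbr a ∖ nbr b) v ≡ false
  nbr∖nbr-empty a b empty v with (nbr a ∖ nbr b) v in v∈
  ... | false = refl
  ... | true with nbr∖nbr-support a b v v∈
  ...   | z , _ , z∈ = trans (sym z∈) (empty z)

  nbr∖nbr-unique : ∀ a b z₀ → (∀ z → (adj G a ∖ adj G b) z ≡ true → z ≡ z₀) →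
                   ∀ v → (nbr a ∖ nbr b) v ≡ true → v ≡ penultimate z₀
  nbr∖nbr-unique a b z₀ unique v v∈ with nbr∖nbr-support a b v v∈
  ... | z , refl , z∈ = cong penultimate (unique z z∈)

module _ (G : Graph) (s : ℕ) (g : MycV G (suc (suc s)) ↔ Fin (n G * suc (suc s) + 1)) where
  open TopLayer G s
  open LabelSums g

  Balanced : Fin (n G) → Fin (n G) → Set
  Balanced a b = labelSum (nbr a ∖ nbr b) ≡ labelSum (nbr b ∖ nbr a)

  ¬balanced-nonempty-empty : ∀ a b {c} → Balanced a b →
    count (adj G a ∖ adj G b) ≡ suc c → count (adj G b ∖ adj G a) ≡ 0 → ⊥
  ¬balanced-nonempty-empty a b balanced nonempty empty
    with count-≡suc (adj G a ∖ adj G b) nonempty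
  ... | z , z∈ = n≮0 (begin
    label (penultimate z)     ≤⟨ label-≤-labelSum {nbr a ∖ nbr b} (trans (nbr∖nbr-penultimate a b z) z∈) ⟩
    labelSum (nbr a ∖ nbr b)  ≡⟨ balanced ⟩
    labelSum (nbr b ∖ nbr a)  ≡⟨ labelSum-empty {nbr b ∖ nbr a} (nbr∖nbr-empty b a (count-≡0 _ empty)) ⟩
    0                         ∎)
    where open ≤-Reasoning

  ¬balanced-singletons : ∀ a b → Balanced a b →
    count (adj G a ∖ adj G b) ≡ 1 → count (adj G b ∖ adj G a) ≡ 1 → ⊥
  ¬balanced-singletons a b balanced single-ab single-ba
    with count-≡1 (adj G a ∖ adj G b) single-ab | count-≡1 (adj G b ∖ adj G a) single-ba
  ... | z₀ , z₀∈ , unique₀ | z₁ , z₁∈ , unique₁ =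
    contradiction (trans (sym (∖-asym (adj G a) (adj G b) z₀ z₀∈)) (subst _ (sym z₀≡z₁) z₁∈)) λ ()
    where
    z₀≡z₁ : z₀ ≡ z₁
    z₀≡z₁ = penultimate-injective (label-injective (begin
      label (penultimate z₀)    ≡⟨ labelSum-single {nbr a ∖ nbr b} z₀∈′ (nbr∖nbr-unique a b z₀ unique₀) ⟨
      labelSum (nbr a ∖ nbr b)  ≡⟨ balanced ⟩
      labelSum (nbr b ∖ nbr a)  ≡⟨ labelSum-single {nbr b ∖ nbr a} z₁∈′ (nbr∖nbr-unique b a z₁ unique₁) ⟩
      label (penultimate z₁)    ∎))
      where
      open ≡-Reasoning
      z₀∈′ = trans (nbr∖nbr-penultimate a b z₀) z₀∈
      z₁∈′ = trans (nbr∖nbr-penultimate b a z₁) z₁∈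

  ¬balanced : ∀ a b → Balanced a b → count (adj G a ∖ adj G b) + count (adj G b ∖ adj G a) ≡ 2 → ⊥
  ¬balanced a b balanced counts with count (adj G a ∖ adj G b) in c-ab
  ... | 0 = ¬balanced-nonempty-empty b a (sym balanced) counts c-ab
  ... | 1 = ¬balanced-singletons a b balanced c-ab (suc-injective counts)
  ... | 2 = ¬balanced-nonempty-empty a b balanced c-ab (suc-injective (suc-injective counts))
  ¬balanced a b balanced () | suc (suc (suc _))

mycielskian-¬distanceMagic : ∀ s G a b → symDiffSize G a b ≡ 2 → ¬ MycDistanceMagic G (suc (suc s))
mycielskian-¬distanceMagic s G a b symDiff≡2 (g , k , magic) =
  ¬balanced G s g a b (labelSum-∖-≡ {nbr a} {nbr b} (trans (magic (top a)) (sym (magic (top b)))))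
                      (trans (sym (count-xor (adj G a) (adj G b))) symDiff≡2)
  where
  open TopLayer G s
  open LabelSums g

lemma2p5 : (t : ℕ) → t ≥ 3 → (G : Graph) → Connected G →
    (xi xj : Fin (n G)) → symDiffSize G xi xj ≡ 2 →
    ¬ MycDistanceMagic G t
lemma2p5 (suc (suc s)) (s≤s (s≤s _)) G _ = mycielskian-¬distanceMagic s G
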